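{- If $G$ is a graph with girth at least $5$ and $\gamma(G) > \delta(G)$, then $cc(H) \geq \delta(G)+1$ where $H$ is obtained from $G$ by subdividing every edge of $G$ exactly once.
   Context: All graphs are finite, reflexive and connected. In the Cops and Attacking Robbers game, play is as in Cops and Robbers, except that if the robber moves onto a vertex occupied by a cop, one such cop is removed from the game; $cc(G)$ denotes the attacking cop number of $G$, the least number of cops that have a strategy guaranteeing capture of the robber in this game on $G$. $\gamma$ is the domination number and $\delta$ the minimum degree. -}

module Defs where

open import Data.Nat using (ℕ; _≤_; _<_)
open import Data.Fin using (Fin)
import Data.Fin as F
open import Data.Fin.Subset using (Subset; _∈_; ∣_∣)
open import Data.Bool using (Bool; true; false; T)
open import Data.Vec using (tabulate)
open import Data.List using (List; []; _∷_; length)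
import Data.List.Membership.Propositional as LM
open import Data.List.Relation.Binary.Pointwise.Base using (Pointwise)
open import Data.Product using (Σ; ∃; _×_; _,_; proj₁; proj₂)
open import Data.Sum using (_⊎_)
open import Data.Empty using (⊥)
open import Relation.Nullary using (¬_)
open import Relation.Binary.PropositionalEquality using (_≡_; _≢_)
open import Relation.Binary.Construct.Closure.ReflexiveTransitive using (Star)

-- Finite simple graphs on Fin n (loops are implicit in the game: a
-- player may always stay put, which models "reflexive").

record Graph : Set where
  field
    n      : ℕ
    adj    : Fin n → Fin n → Bool
    sym    : ∀ u v → adj u v ≡ adj v u
    irrefl : ∀ v → adj v v ≡ false

module _ (G : Graph) where
  open Graph G

  Adj : Fin n → Fin n → Set
  Adj u v = T (adj u v)

  Connected : Set
  Connected = (1 ≤ n) × (∀ u v → Star Adj u v)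

  Girth≥5 : Set
  Girth≥5 =
    (∀ a b c → Adj a b → Adj b c → Adj c a → ⊥) ×
    (∀ a b c d → Adj a b → Adj b c → Adj c d → Adj d a → a ≢ c → b ≢ d → ⊥)

  nbhd : Fin n → Subset n
  nbhd v = tabulate (adj v)

  degree : Fin n → ℕ
  degree v = ∣ nbhd v ∣

  IsMinDegree : ℕ → Set
  IsMinDegree d = (∃ λ v → degree v ≡ d) × (∀ v → d ≤ degree v)

  Dominating : Subset n → Set
  Dominating D = ∀ v → v ∈ D ⊎ (∃ λ u → u ∈ D × Adj u v)

  DominationNumber> : ℕ → Set
  DominationNumber> d = ∀ D → Dominating D → d < ∣ D ∣

  -- The subdivision H of G: one new vertex per edge {u,v} (u < v).

  Edge : Set
  Edge = Σ (Fin n × Fin n) (λ p → (proj₁ p F.< proj₂ p) × Adj (proj₁ p) (proj₂ p))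

  SubV : Set
  SubV = Fin n ⊎ Edge

  SubAdj : SubV → SubV → Set
  SubAdj (_⊎_.inj₁ x) (_⊎_.inj₂ ((u , v) , _)) = x ≡ u ⊎ x ≡ v
  SubAdj (_⊎_.inj₂ ((u , v) , _)) (_⊎_.inj₁ x) = x ≡ u ⊎ x ≡ v
  SubAdj (_⊎_.inj₁ _) (_⊎_.inj₁ _) = ⊥
  SubAdj (_⊎_.inj₂ _) (_⊎_.inj₂ _) = ⊥

-- Cops and Attacking Robbers on a graph with vertex type V and
-- (irreflexive) adjacency E; players may stay put.

module AttackGame {V : Set} (E : V → V → Set) where
  open LM using () renaming (_∈_ to _∈ₗ_)

  Step : V → V → Set
  Step a b = a ≡ b ⊎ E a b

  data Remove (x : V) : List V → List V → Set where
    here  : ∀ {xs} → Remove x (x ∷ xs) xs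
    there : ∀ {y xs ys} → Remove x xs ys → Remove x (y ∷ xs) (y ∷ ys)

  AfterAttack : List V → V → List V → Set
  AfterAttack cs r cs'' = ((¬ (r ∈ₗ cs)) × (cs'' ≡ cs)) ⊎ Remove r cs cs''

  data CopsWinFrom (cs : List V) (r : V) : Set where
    move : (cs' : List V) → Pointwise Step cs cs' →
           (r ∈ₗ cs' ⊎
            (∀ r' → Step r r' → ∀ cs'' → AfterAttack cs' r' cs'' → CopsWinFrom cs'' r')) →
           CopsWinFrom cs r

  -- k cops have a winning strategy: they place, the robber places
  -- (placing on a cop means capture), then cops move first
  CopsWin : ℕ → Set
  CopsWin k = Σ (List V) λ cs → (length cs ≡ k) × (∀ r → r ∈ₗ cs ⊎ CopsWinFrom cs r)

{-# OPTIONS --safe #-}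
module Submission where

open import Defs
open import Data.Nat using (ℕ; _≤_; _<_; _+_; z≤n; s≤s)
open import Data.Nat.Properties
  using (≤-refl; ≤-trans; <⇒≤; ≤-reflexive; <-≤-trans; ≤⇒≯; n≤1+n; +-suc; +-monoʳ-≤; +-mono-≤)
open import Data.Fin using (Fin; zero; suc; _≟_)
open import Data.Fin.Properties using (<-cmp; ¬∀⟶∃¬) renaming (any? to anyFin?)
open import Data.Fin.Subset using (Subset; inside; outside; _∈_; _∉_; _∪_; _∩_; ⋃; ⁅_⁆; ∣_∣)
open import Data.Fin.Subset.Properties
  using (_∈?_; drop-there; x∈p∩q⁺; x∈p∩q⁻; x∈p∪q⁺; x∈⁅x⁆; ∣⁅x⁆∣≡1; ∣⊥∣≡0; p⊆q⇒∣p∣≤∣q∣;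
         nonempty?; Empty-unique)
open import Data.Bool using (Bool; T)
open import Data.Bool.Properties using (T?; T-≡)
open import Data.Vec using ([]; _∷_; here; there; tabulate)
open import Data.Vec.Properties using (lookup∘tabulate; lookup⇒[]=; []=⇒lookup)
open import Data.List using (List; []; _∷_; length; map)
open import Data.List.Membership.Propositional using (find; lose) renaming (_∈_ to _∈ₗ_)
open import Data.List.Relation.Unary.Any using (Any; here; there; any?)
open import Data.List.Relation.Binary.Pointwise using (Pointwise; []; _∷_; Pointwise-length)
open import Data.Product using (Σ; ∃; ∃₂; _×_; _,_; proj₁; proj₂)
open import Data.Sum using (_⊎_; inj₁; inj₂; [_,_]; map₂; swap)
open import Data.Empty using (⊥; ⊥-elim)
open import Function using (_∘_; Equivalence)
open import Relation.Nullary using (¬_; Dec; yes; no)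
open import Relation.Nullary.Decidable using (_⊎-dec_; _×-dec_; ⌊_⌋; toWitness; fromWitness)
open import Relation.Unary using (Decidable)
open import Relation.Binary using (tri<; tri≈; tri>)
open import Relation.Binary.PropositionalEquality using (_≡_; _≢_; refl; sym; trans; cong; subst)

-- Robber's strategy on the subdivision H of G against at most δ cops: stand on an
-- original vertex w of G with no cop within distance one.  Initially such a w exists,
-- because charging every cop to an original vertex (a cop on the subdivision vertex of ab
-- to a, which dominates a and b) yields at most δ < γ vertices, which do not dominate G.
-- When a cop steps next to w, onto the subdivision vertex of an edge wu, the robber
-- discounts that cop: since none is at w and G has neither triangles nor 4-cycles, each
-- of the at most δ − 1 others is within distance two of at most one of the ≥ δ
-- neighbours of w, so some neighbour x of w has no cop within distance two.  The robber
-- steps towards x (attacking the cop on wu if x = u) and reaches x next turn, again with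
-- no cop within distance one.

∣p∪q∣≤∣p∣+∣q∣ : ∀ {n} (p q : Subset n) → ∣ p ∪ q ∣ ≤ ∣ p ∣ + ∣ q ∣
∣p∪q∣≤∣p∣+∣q∣ []            []            = z≤n
∣p∪q∣≤∣p∣+∣q∣ (inside  ∷ p) (inside  ∷ q) = s≤s (≤-trans (∣p∪q∣≤∣p∣+∣q∣ p q) (+-monoʳ-≤ ∣ p ∣ (n≤1+n ∣ q ∣)))
∣p∪q∣≤∣p∣+∣q∣ (inside  ∷ p) (outside ∷ q) = s≤s (∣p∪q∣≤∣p∣+∣q∣ p q)
∣p∪q∣≤∣p∣+∣q∣ (outside ∷ p) (inside  ∷ q) = ≤-trans (s≤s (∣p∪q∣≤∣p∣+∣q∣ p q)) (≤-reflexive (sym (+-suc ∣ p ∣ ∣ q ∣)))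
∣p∪q∣≤∣p∣+∣q∣ (outside ∷ p) (outside ∷ q) = ∣p∪q∣≤∣p∣+∣q∣ p q

subsingleton⇒∣p∣≤1 : ∀ {n} {p : Subset n} → (∀ {x y} → x ∈ p → y ∈ p → x ≡ y) → ∣ p ∣ ≤ 1
subsingleton⇒∣p∣≤1 {n} {p} unique with nonempty? p
... | yes (x , x∈p) = ≤-trans (p⊆q⇒∣p∣≤∣q∣ (λ y∈p → subst (_∈ ⁅ x ⁆) (unique x∈p y∈p) (x∈⁅x⁆ x)))
                              (≤-reflexive (∣⁅x⁆∣≡1 x))
... | no empty = subst (λ q → ∣ q ∣ ≤ 1) (sym (Empty-unique empty)) (≤-trans (≤-reflexive (∣⊥∣≡0 n)) z≤n)

∃∈p∉q⇒∃∈∷p∉∷q : ∀ {n s t} {p q : Subset n} → (∃ λ x → x ∈ p × x ∉ q) → ∃ λ x → x ∈ s ∷ p × x ∉ t ∷ q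
∃∈p∉q⇒∃∈∷p∉∷q (x , x∈p , x∉q) = suc x , there x∈p , x∉q ∘ drop-there

∣q∣<∣p∣⇒∃∈p∉q : ∀ {n} (p q : Subset n) → ∣ q ∣ < ∣ p ∣ → ∃ λ x → x ∈ p × x ∉ q
∣q∣<∣p∣⇒∃∈p∉q (inside  ∷ p) (outside ∷ q) _       = zero , here , λ ()
∣q∣<∣p∣⇒∃∈p∉q (inside  ∷ p) (inside  ∷ q) (s≤s lt) = ∃∈p∉q⇒∃∈∷p∉∷q (∣q∣<∣p∣⇒∃∈p∉q p q lt)
∣q∣<∣p∣⇒∃∈p∉q (outside ∷ p) (outside ∷ q) lt       = ∃∈p∉q⇒∃∈∷p∉∷q (∣q∣<∣p∣⇒∃∈p∉q p q lt)
∣q∣<∣p∣⇒∃∈p∉q (outside ∷ p) (inside  ∷ q) lt       = ∃∈p∉q⇒∃∈∷p∉∷q (∣q∣<∣p∣⇒∃∈p∉q p q (≤-trans (n≤1+n _) lt))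

x∈tabulate⁺ : ∀ {n} (f : Fin n → Bool) {x} → T (f x) → x ∈ tabulate f
x∈tabulate⁺ f {x} fx = lookup⇒[]= x (tabulate f) (trans (lookup∘tabulate f x) (Equivalence.to T-≡ fx))

x∈tabulate⁻ : ∀ {n} (f : Fin n → Bool) {x} → x ∈ tabulate f → T (f x)
x∈tabulate⁻ f {x} x∈ = Equivalence.from T-≡ (trans (sym (lookup∘tabulate f x)) ([]=⇒lookup x∈))

module _ {n} {A : Set} (f : A → Subset n) where

  ∈⋃map⁺ : ∀ {xs a x} → a ∈ₗ xs → x ∈ f a → x ∈ ⋃ (map f xs)
  ∈⋃map⁺ (here refl) x∈ = x∈p∪q⁺ (inj₁ x∈)
  ∈⋃map⁺ (there a∈)  x∈ = x∈p∪q⁺ (inj₂ (∈⋃map⁺ a∈ x∈))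

  ∣⋃map∣≤length : ∀ xs → (∀ {a} → a ∈ₗ xs → ∣ f a ∣ ≤ 1) → ∣ ⋃ (map f xs) ∣ ≤ length xs
  ∣⋃map∣≤length []       _     = ≤-reflexive (∣⊥∣≡0 n)
  ∣⋃map∣≤length (a ∷ xs) small =
    ≤-trans (∣p∪q∣≤∣p∣+∣q∣ (f a) _) (+-mono-≤ (small (here refl)) (∣⋃map∣≤length xs (small ∘ there)))

  ∃-uncovered : ∀ (S : Subset n) xs → (∀ {a} → a ∈ₗ xs → ∣ f a ∣ ≤ 1) → length xs < ∣ S ∣ →
                ∃ λ x → x ∈ S × ∀ {a} → a ∈ₗ xs → x ∉ f a
  ∃-uncovered S xs small lt =
    let x , x∈S , x∉⋃ = ∣q∣<∣p∣⇒∃∈p∉q S _ (≤-trans (s≤s (∣⋃map∣≤length xs small)) lt)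
    in  x , x∈S , λ a∈ x∈ → x∉⋃ (∈⋃map⁺ a∈ x∈)

∈-Pointwise⁻ : ∀ {V : Set} {R : V → V → Set} {xs ys y} → Pointwise R xs ys → y ∈ₗ ys →
               ∃ λ x → x ∈ₗ xs × R x y
∈-Pointwise⁻ (r ∷ _)  (here refl) = _ , here refl , r
∈-Pointwise⁻ (_ ∷ rs) (there y∈)  = let x , x∈ , r = ∈-Pointwise⁻ rs y∈ in x , there x∈ , r

module Evasion {V : Set} (E : V → V → Set) where
  open AttackGame E

  remove : ∀ {x xs} → x ∈ₗ xs → ∃ λ ys → Remove x xs ys
  remove (here refl) = _ , here
  remove (there x∈)  = let ys , r = remove x∈ in _ ∷ ys , there r

  Remove-length< : ∀ {x xs ys} → Remove x xs ys → length ys < length xs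
  Remove-length< here      = ≤-refl
  Remove-length< (there r) = s≤s (Remove-length< r)

  Remove-⊆ : ∀ {x xs ys c} → Remove x xs ys → c ∈ₗ ys → c ∈ₗ xs
  Remove-⊆ here      c∈          = there c∈
  Remove-⊆ (there r) (here refl) = here refl
  Remove-⊆ (there r) (there c∈)  = there (Remove-⊆ r c∈)

  Remove-∈ : ∀ {x xs ys c} → Remove x xs ys → c ∈ₗ xs → c ≡ x ⊎ c ∈ₗ ys
  Remove-∈ here      (here refl) = inj₁ refl
  Remove-∈ here      (there c∈)  = inj₂ c∈
  Remove-∈ (there r) (here refl) = inj₂ (here refl)
  Remove-∈ (there r) (there c∈)  = map₂ there (Remove-∈ r c∈)

  Step² : V → V → Set
  Step² c v = ∃ λ m → Step c m × Step m v

  moved-¬Step⇒≢ : ∀ {cs cs′ v} → Pointwise Step cs cs′ → (∀ {c} → c ∈ₗ cs → ¬ Step c v) →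
                  ∀ {c} → c ∈ₗ cs′ → c ≢ v
  moved-¬Step⇒≢ moves far c∈ refl = let c₀ , c₀∈ , s = ∈-Pointwise⁻ moves c∈ in far c₀∈ s

  moved-¬Step²⇒¬Step : ∀ {cs cs′ v} → Pointwise Step cs cs′ → (∀ {c} → c ∈ₗ cs → ¬ Step² c v) →
                       ∀ {c} → c ∈ₗ cs′ → ¬ Step c v
  moved-¬Step²⇒¬Step moves far c∈ s = let c₀ , c₀∈ , s₀ = ∈-Pointwise⁻ moves c∈ in far c₀∈ (_ , s₀ , s)

  SafeMove : (List V → V → Set) → List V → V → Set
  SafeMove Safe cs r = ∃₂ λ r′ cs′ → Step r r′ × AfterAttack cs r′ cs′ × Safe cs′ r′

  Invariant : (List V → V → Set) → Set
  Invariant Safe = ∀ {cs cs′ r} → Safe cs r → Pointwise Step cs cs′ → ¬ r ∈ₗ cs′ × SafeMove Safe cs′ r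

  invariant⇒¬CopsWinFrom : ∀ {Safe} → Invariant Safe → ∀ {cs r} → Safe cs r → ¬ CopsWinFrom cs r
  invariant⇒¬CopsWinFrom inv safe (move cs′ moves outcome) with inv safe moves | outcome
  ... | r∉ , _ | inj₁ r∈ = r∉ r∈
  ... | _ , r′ , cs″ , step , attack , safe′ | inj₂ continue =
    invariant⇒¬CopsWinFrom inv safe′ (continue r′ step cs″ attack)

module Subdivision (G : Graph) where
  open Graph G using (n; adj) renaming (sym to adj-sym; irrefl to adj-irrefl)
  open AttackGame (SubAdj G)
  open Evasion (SubAdj G)

  V : Set
  V = SubV G

  Adj-sym : ∀ {u v} → Adj G u v → Adj G v u
  Adj-sym {u} {v} = subst T (adj-sym u v)

  Adj-irrefl : ∀ {u} → ¬ Adj G u u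
  Adj-irrefl {u} = subst T (adj-irrefl u)

  x∈nbhd⁻ : ∀ {w x} → x ∈ nbhd G w → Adj G w x
  x∈nbhd⁻ {w} = x∈tabulate⁻ (adj w)

  adjacent? : ∀ c w → Dec (SubAdj G c (inj₁ w))
  adjacent? (inj₁ _)              w = no λ ()
  adjacent? (inj₂ ((a , b) , _)) w = (w ≟ a) ⊎-dec (w ≟ b)

  edgeBetween : ∀ {u v} → Adj G u v → Σ (Edge G) λ e → SubAdj G (inj₂ e) (inj₁ u) × SubAdj G (inj₂ e) (inj₁ v)
  edgeBetween {u} {v} uv with <-cmp u v
  ... | tri< u<v _ _ = ((u , v) , u<v , uv) , inj₁ refl , inj₂ refl
  ... | tri≈ _ refl _ = ⊥-elim (Adj-irrefl uv)
  ... | tri> _ _ v<u = ((v , u) , v<u , Adj-sym uv) , inj₂ refl , inj₁ refl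

  otherEnd : ∀ e {w} → SubAdj G (inj₂ e) (inj₁ w) →
             ∃ λ u → SubAdj G (inj₂ e) (inj₁ u) × (∀ {y} → SubAdj G (inj₂ e) (inj₁ y) → y ≡ w ⊎ y ≡ u)
  otherEnd ((a , b) , _) (inj₁ refl) = b , inj₂ refl , λ y∈e → y∈e
  otherEnd ((a , b) , _) (inj₂ refl) = a , inj₁ refl , swap

  -- The original vertices within distance two of c in H.
  Shadow : V → Fin n → Set
  Shadow (inj₁ z) x = z ≡ x ⊎ Adj G z x
  Shadow (inj₂ e) x = SubAdj G (inj₂ e) (inj₁ x)

  shadow? : ∀ c → Decidable (Shadow c)
  shadow? (inj₁ z) x = (z ≟ x) ⊎-dec T? (adj z x)
  shadow? (inj₂ e) x = adjacent? (inj₂ e) x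

  shadow : V → Subset n
  shadow c = tabulate (λ x → ⌊ shadow? c x ⌋)

  x∈shadow⁺ : ∀ c {x} → Shadow c x → x ∈ shadow c
  x∈shadow⁺ c s = x∈tabulate⁺ _ (fromWitness {a? = shadow? c _} s)

  x∈shadow⁻ : ∀ c {x} → x ∈ shadow c → Shadow c x
  x∈shadow⁻ c x∈ = toWitness {a? = shadow? c _} (x∈tabulate⁻ _ x∈)

  Step²⇒Shadow : ∀ c {x} → Step² c (inj₁ x) → Shadow c x
  Step²⇒Shadow (inj₁ z) (_ , inj₁ refl , inj₁ refl) = inj₁ refl
  Step²⇒Shadow (inj₁ z) (inj₂ ((a , b) , _ , ab) , inj₂ za , inj₂ xa) with za | xa
  ... | inj₁ refl | inj₁ refl = inj₁ refl
  ... | inj₁ refl | inj₂ refl = inj₂ ab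
  ... | inj₂ refl | inj₁ refl = inj₂ (Adj-sym ab)
  ... | inj₂ refl | inj₂ refl = inj₁ refl
  Step²⇒Shadow (inj₂ e) (_ , inj₁ refl , inj₂ ex) = ex
  Step²⇒Shadow (inj₂ e) (inj₁ z , inj₂ ez , inj₁ refl) = ez

  undominated : ∀ D → ¬ Dominating G D → ∃ λ v → v ∉ D × ∀ {u} → u ∈ D → ¬ Adj G u v
  undominated D ¬dominating =
    let v , ¬dominated = ¬∀⟶∃¬ n _ dominated? ¬dominating
    in  v , ¬dominated ∘ inj₁ , λ u∈ uv → ¬dominated (inj₂ (_ , u∈ , uv))
    where
    dominated? : ∀ v → Dec (v ∈ D ⊎ ∃ λ u → u ∈ D × Adj G u v)
    dominated? v = (v ∈? D) ⊎-dec anyFin? (λ u → (u ∈? D) ×-dec T? (adj u v))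

  anchor : V → Fin n
  anchor (inj₁ u)              = u
  anchor (inj₂ ((a , b) , _)) = a

  anchors : List V → Subset n
  anchors cs = ⋃ (map (⁅_⁆ ∘ anchor) cs)

  anchor∈anchors : ∀ {c cs} → c ∈ₗ cs → anchor c ∈ anchors cs
  anchor∈anchors {c} c∈ = ∈⋃map⁺ _ c∈ (x∈⁅x⁆ (anchor c))

  ∣anchors∣≤length : ∀ cs → ∣ anchors cs ∣ ≤ length cs
  ∣anchors∣≤length cs = ∣⋃map∣≤length _ cs (λ {c} _ → ≤-reflexive (∣⁅x⁆∣≡1 (anchor c)))

  Step⇒dominatedByAnchor : ∀ c {w} → Step c (inj₁ w) → anchor c ≡ w ⊎ Adj G (anchor c) w
  Step⇒dominatedByAnchor (inj₁ u)           (inj₁ refl)        = inj₁ refl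
  Step⇒dominatedByAnchor (inj₂ _)           (inj₂ (inj₁ refl)) = inj₁ refl
  Step⇒dominatedByAnchor (inj₂ (_ , _ , ab)) (inj₂ (inj₂ refl)) = inj₂ ab

  module _ (girth : Girth≥5 G) where
    noTriangle : ∀ a b c → Adj G a b → Adj G b c → Adj G c a → ⊥
    noTriangle = proj₁ girth

    noSquare : ∀ a b c d → Adj G a b → Adj G b c → Adj G c d → Adj G d a → a ≢ c → b ≢ d → ⊥
    noSquare = proj₂ girth

    shadow-unique : ∀ c {w x y} → c ≢ inj₁ w → Adj G w x → Adj G w y → Shadow c x → Shadow c y → x ≡ y
    shadow-unique (inj₁ z) _  _  _  (inj₁ refl) (inj₁ refl) = refl
    shadow-unique (inj₁ z) _  wx wy (inj₁ refl) (inj₂ xy)   = ⊥-elim (noTriangle _ _ _ wx xy (Adj-sym wy))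
    shadow-unique (inj₁ z) _  wx wy (inj₂ yx)   (inj₁ refl) = ⊥-elim (noTriangle _ _ _ wy yx (Adj-sym wx))
    shadow-unique (inj₁ z) {x = x} {y} c≢w wx wy (inj₂ zx) (inj₂ zy) with x ≟ y
    ... | yes x≡y = x≡y
    ... | no x≢y  = ⊥-elim (noSquare _ _ _ _ wx (Adj-sym zx) zy (Adj-sym wy) (c≢w ∘ cong inj₁ ∘ sym) x≢y)
    shadow-unique (inj₂ _)           _ _  _  (inj₁ refl) (inj₁ refl) = refl
    shadow-unique (inj₂ (_ , _ , ab)) _ wx wy (inj₁ refl) (inj₂ refl) = ⊥-elim (noTriangle _ _ _ wx ab (Adj-sym wy))
    shadow-unique (inj₂ (_ , _ , ab)) _ wx wy (inj₂ refl) (inj₁ refl) =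
      ⊥-elim (noTriangle _ _ _ wx (Adj-sym ab) (Adj-sym wy))
    shadow-unique (inj₂ _)           _ _  _  (inj₂ refl) (inj₂ refl) = refl

    ∃-unshadowed-neighbour : ∀ w cs → length cs < degree G w → (∀ {c} → c ∈ₗ cs → c ≢ inj₁ w) →
                             ∃ λ x → Adj G w x × ∀ {c} → c ∈ₗ cs → ¬ Step² c (inj₁ x)
    ∃-unshadowed-neighbour w cs lt c≢w =
      let x , x∈N , unshadowed = ∃-uncovered (λ c → nbhd G w ∩ shadow c) (nbhd G w) cs atMostOne lt
      in  x , x∈nbhd⁻ x∈N , λ {c} c∈ s → unshadowed c∈ (x∈p∩q⁺ (x∈N , x∈shadow⁺ c (Step²⇒Shadow c s)))
      where
      atMostOne : ∀ {c} → c ∈ₗ cs → ∣ nbhd G w ∩ shadow c ∣ ≤ 1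
      atMostOne {c} c∈ = subsingleton⇒∣p∣≤1 λ x∈ y∈ →
        let x∈N , x∈S = x∈p∩q⁻ (nbhd G w) (shadow c) x∈
            y∈N , y∈S = x∈p∩q⁻ (nbhd G w) (shadow c) y∈
        in  shadow-unique c (c≢w c∈) (x∈nbhd⁻ x∈N) (x∈nbhd⁻ y∈N) (x∈shadow⁻ c x∈S) (x∈shadow⁻ c y∈S)

module Strategy (G : Graph) (girth : Girth≥5 G) (d : ℕ) (δ≤degree : ∀ v → d ≤ degree G v) where
  open Subdivision G
  open AttackGame (SubAdj G)
  open Evasion (SubAdj G)

  data Safe (cs : List V) : V → Set where
    atVertex : ∀ {w} → length cs ≤ d → (∀ {c} → c ∈ₗ cs → ¬ Step c (inj₁ w)) → Safe cs (inj₁ w)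
    onEdge   : ∀ {e t} → length cs ≤ d → SubAdj G (inj₂ e) (inj₁ t) →
               (∀ {c} → c ∈ₗ cs → ¬ Step² c (inj₁ t)) → Safe cs (inj₂ e)

  cornered : ∀ {cs w e₀} → length cs ≤ d → (∀ {c} → c ∈ₗ cs → c ≢ inj₁ w) →
             inj₂ e₀ ∈ₗ cs → SubAdj G (inj₂ e₀) (inj₁ w) → SafeMove Safe cs (inj₁ w)
  cornered {cs} {w} {e₀} len c≢w e₀∈ e₀w with otherEnd e₀ e₀w | remove e₀∈
  ... | u , e₀u , endsOf-e₀ | cs₀ , removed
    with ∃-unshadowed-neighbour girth w cs₀ lt (c≢w ∘ Remove-⊆ removed)
    where
    lt : length cs₀ < degree G w
    lt = <-≤-trans (Remove-length< removed) (≤-trans len (δ≤degree w))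
  ... | x , wx , unshadowed with x ≟ u
  ... | yes refl = inj₂ e₀ , cs₀ , inj₂ e₀w , inj₂ removed ,
                   onEdge (≤-trans (<⇒≤ (Remove-length< removed)) len) e₀u unshadowed
  ... | no x≢u = let e , ew , ex = edgeBetween wx in
                 inj₂ e , cs , inj₂ ew , inj₁ ((λ e∈ → unshadowed′ e∈ (_ , inj₁ refl , inj₂ ex)) , refl) ,
                 onEdge len ex unshadowed′
    where
    unshadowed′ : ∀ {c} → c ∈ₗ cs → ¬ Step² c (inj₁ x)
    unshadowed′ c∈ s with Remove-∈ removed c∈
    ... | inj₂ c∈₀ = unshadowed c∈₀ s
    ... | inj₁ refl with endsOf-e₀ (Step²⇒Shadow (inj₂ e₀) s)
    ...   | inj₁ refl = Adj-irrefl wx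
    ...   | inj₂ x≡u  = x≢u x≡u

  safe-invariant : Invariant Safe
  safe-invariant {cs′ = cs′} (onEdge {e} {t} len et unshadowed) moves =
    e∉ , inj₁ t , cs′ , inj₂ et , inj₁ ((λ t∈ → near t∈ (inj₁ refl)) , refl) ,
    atVertex (subst (_≤ d) (Pointwise-length moves) len) near
    where
    near : ∀ {c} → c ∈ₗ cs′ → ¬ Step c (inj₁ t)
    near = moved-¬Step²⇒¬Step moves unshadowed
    e∉ : ¬ inj₂ e ∈ₗ cs′
    e∉ e∈ = moved-¬Step⇒≢ moves (λ c∈ s → unshadowed c∈ (_ , s , inj₂ et)) e∈ refl
  safe-invariant {cs′ = cs′} (atVertex {w} len far) moves = w∉ , escape (any? (λ c → adjacent? c w) cs′)
    where
    len′ : length cs′ ≤ d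
    len′ = subst (_≤ d) (Pointwise-length moves) len
    c≢w : ∀ {c} → c ∈ₗ cs′ → c ≢ inj₁ w
    c≢w = moved-¬Step⇒≢ moves far
    w∉ : ¬ inj₁ w ∈ₗ cs′
    w∉ w∈ = c≢w w∈ refl
    escape : Dec (Any (λ c → SubAdj G c (inj₁ w)) cs′) → SafeMove Safe cs′ (inj₁ w)
    escape (yes adjacentCop) with find adjacentCop
    ... | inj₂ e₀ , e₀∈ , e₀w = cornered len′ c≢w e₀∈ e₀w
    escape (no noAdjacentCop) =
      inj₁ w , cs′ , inj₁ refl , inj₁ (w∉ , refl) , atVertex len′ (λ c∈ → [ c≢w c∈ , noAdjacentCop ∘ lose c∈ ])

  safe⇒∉ : ∀ {cs r} → Safe cs r → ¬ r ∈ₗ cs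
  safe⇒∉ (atVertex _ far)         r∈ = far r∈ (inj₁ refl)
  safe⇒∉ (onEdge _ et unshadowed) r∈ = unshadowed r∈ (_ , inj₁ refl , inj₂ et)

  safeStart : ∀ cs → length cs ≤ d → DominationNumber> G d → ∃ λ w → Safe cs (inj₁ w)
  safeStart cs len γ>d with undominated (anchors cs) (≤⇒≯ (≤-trans (∣anchors∣≤length cs) len) ∘ γ>d _)
  ... | w , w∉D , ¬adj = w , atVertex len far
    where
    far : ∀ {c} → c ∈ₗ cs → ¬ Step c (inj₁ w)
    far {c} c∈ s with Step⇒dominatedByAnchor c s
    ... | inj₁ refl = w∉D (anchor∈anchors c∈)
    ... | inj₂ aw   = ¬adj (anchor∈anchors c∈) aw

mainTheorem5 : (G : Graph) → Connected G → Girth≥5 G →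
    (d : ℕ) → IsMinDegree G d → DominationNumber> G d →
    ∀ k → k ≤ d → ¬ AttackGame.CopsWin (SubAdj G) k
mainTheorem5 G _ girth d (_ , δ≤degree) γ>d _ k≤d (cs , refl , copsWin) =
  let w , safe = safeStart cs k≤d γ>d
  in  [ safe⇒∉ safe , invariant⇒¬CopsWinFrom safe-invariant safe ] (copsWin (inj₁ w))
  where
  open Strategy G girth d δ≤degree
  open Evasion (SubAdj G) using (invariant⇒¬CopsWinFrom)
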